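{- Let $G$ and $H$ be graphs on disjoint vertex sets, each admitting a good edge-labelling. Let $G'$ be obtained from the disjoint union of $G$ and $H$ by adding a set $M$ of edges such that each edge of $M$ has one endpoint in $V(G)$ and the other in $V(H)$, and every vertex of $V(G)\cup V(H)$ is incident to at most one edge of $M$. Then $G'$ admits a good edge-labelling.
   Context: All graphs are finite and simple. A good edge-labelling of a graph $G$ is a map $\phi:E(G)\to\mathbb{R}$ such that for every ordered pair of vertices $(u,v)$ there is at most one nondecreasing path from $u$ to $v$, i.e. at most one path $u=v_0,v_1,\dots,v_t=v$ with $\phi(v_0v_1)\le\dots\le\phi(v_{t-1}v_t)$.
   Formalization: Good edge-labellings, for G and H as well as for G′, take their edge labels in ℚ instead of ℝ. -}

module Defs where

open import Data.Bool using (Bool; true; false; T)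
open import Data.Fin using (Fin)
open import Data.Nat using (ℕ)
open import Data.Sum using (_⊎_; inj₁; inj₂)
open import Data.Product using (_×_; Σ)
open import Data.Unit using (⊤)
open import Data.Maybe using (just)
open import Data.List using (List; []; _∷_; head; last)
open import Data.List.Relation.Unary.Unique.Propositional using (Unique)
open import Data.List.Relation.Unary.Linked using (Linked)
open import Data.Rational using (ℚ; _≤_)
open import Relation.Binary.PropositionalEquality using (_≡_; subst; sym)

record Graph (V : Set) : Set where
  field
    adj    : V → V → Bool
    adj-sym   : ∀ u v → adj u v ≡ adj v u
    adj-irrefl : ∀ u → adj u u ≡ false

open Graph public

Adj : {V : Set} → Graph V → V → V → Set
Adj G u v = T (adj G u v)

Adj-sym : {V : Set} (G : Graph V) {u v : V} → Adj G u v → Adj G v u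
Adj-sym G {u} {v} e = subst T (adj-sym G u v) e

-- An edge-labelling: a label for every edge, independent of orientation.
-- (Real labels are replaced by rational labels.)
record EdgeLabelling {V : Set} (G : Graph V) : Set where
  field
    lab     : (u v : V) → Adj G u v → ℚ
    lab-sym : ∀ u v (e : Adj G u v) → lab u v e ≡ lab v u (Adj-sym G e)

open EdgeLabelling public

Edges : {V : Set} (G : Graph V) → List V → Set
Edges G []            = ⊤
Edges G (x ∷ [])      = ⊤
Edges G (x ∷ y ∷ ys)  = Adj G x y × Edges G (y ∷ ys)

labels : {V : Set} (G : Graph V) (φ : EdgeLabelling G) (xs : List V) → Edges G xs → List ℚ
labels G φ []           _        = []
labels G φ (x ∷ [])     _        = []
labels G φ (x ∷ y ∷ ys) (e Data.Product., es) = lab φ x y e ∷ labels G φ (y ∷ ys) es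

NondecPath : {V : Set} (G : Graph V) (φ : EdgeLabelling G) (u v : V) (xs : List V) → Set
NondecPath G φ u v xs =
  (head xs ≡ just u) × (last xs ≡ just v) × Unique xs ×
  Σ (Edges G xs) (λ es → Linked _≤_ (labels G φ xs es))

IsGood : {V : Set} (G : Graph V) → EdgeLabelling G → Set
IsGood {V} G φ = ∀ (u v : V) (xs ys : List V) →
  NondecPath G φ u v xs → NondecPath G φ u v ys → xs ≡ ys

AdmitsGood : {V : Set} → Graph V → Set
AdmitsGood G = Σ (EdgeLabelling G) (IsGood G)

IsCrossMatching : {m n : ℕ} → (Fin m → Fin n → Bool) → Set
IsCrossMatching M =
  (∀ a b b′ → T (M a b) → T (M a b′) → b ≡ b′) ×
  (∀ a a′ b → T (M a b) → T (M a′ b) → a ≡ a′)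

glueAdj : {m n : ℕ} → Graph (Fin m) → Graph (Fin n) → (Fin m → Fin n → Bool) →
          Fin m ⊎ Fin n → Fin m ⊎ Fin n → Bool
glueAdj G H M (inj₁ a) (inj₁ a′) = adj G a a′
glueAdj G H M (inj₂ b) (inj₂ b′) = adj H b b′
glueAdj G H M (inj₁ a) (inj₂ b)  = M a b
glueAdj G H M (inj₂ b) (inj₁ a)  = M a b

glue : {m n : ℕ} → Graph (Fin m) → Graph (Fin n) → (Fin m → Fin n → Bool) →
       Graph (Fin m ⊎ Fin n)
glue G H M = record
  { adj = glueAdj G H M
  ; adj-sym = s
  ; adj-irrefl = i }
  where
    s : ∀ x y → glueAdj G H M x y ≡ glueAdj G H M y x
    s (inj₁ a) (inj₁ a′) = adj-sym G a a′
    s (inj₂ b) (inj₂ b′) = adj-sym H b b′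
    s (inj₁ a) (inj₂ b)  = Relation.Binary.PropositionalEquality.refl
    s (inj₂ b) (inj₁ a)  = Relation.Binary.PropositionalEquality.refl
    i : ∀ x → glueAdj G H M x x ≡ false
    i (inj₁ a) = adj-irrefl G a
    i (inj₂ b) = adj-irrefl H b

-- Give every edge between G and H the same label c, larger than every label of G and H.
-- A nondecreasing path starting in G then stays in G until it uses a matching edge;
-- after that it cannot go on: an edge of H has a smaller label, and the only matching
-- edge at its endpoint leads back to the vertex just left. So a nondecreasing path from
-- a vertex of G is a nondecreasing path of G, possibly followed by one matching edge,
-- and the latter is determined by its endpoint since M is a matching. Paths starting
-- in H are handled by exchanging the roles of G and H.
module Submission where

open import Defs
open import Data.Bool using (Bool; true; false; T)
open import Data.Bool.Properties using (T-irrelevant)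
open import Data.Empty using (⊥-elim)
open import Data.Fin using (Fin; zero; suc)
open import Data.List using (List; []; _∷_; _++_; _∷ʳ_; map; head; last)
open import Data.List.Properties using (head-map; last-map; map-injective)
open import Data.List.Relation.Unary.All using ([]; _∷_)
open import Data.List.Relation.Unary.All.Properties as All using ()
open import Data.List.Relation.Unary.AllPairs using ([]; _∷_)
open import Data.List.Relation.Unary.Linked as Linked using (Linked; []; [-]; _∷_)
open import Data.List.Relation.Unary.Unique.Propositional using (Unique)
open import Data.List.Relation.Unary.Unique.Propositional.Properties as Unique using ()
open import Data.Maybe as Maybe using (Maybe; just)
open import Data.Maybe.Properties using (just-injective)
open import Data.Nat using (ℕ; zero; suc)
open import Data.Product using (Σ; _×_; _,_; proj₁; proj₂)
open import Data.Rational using (ℚ; _≤_; _<_; _⊔_; _+_; 0ℚ; 1ℚ)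
open import Data.Rational.Properties
  using (≤-refl; ≤-trans; <-irrefl; <-≤-trans; ≤-<-trans; p≤p⊔q; p≤q⊔p; +-monoʳ-<; +-identityʳ; positive⁻¹)
open import Data.Sum using (_⊎_; inj₁; inj₂; swap)
open import Data.Sum.Properties using (inj₁-injective; swap-involutive)
open import Data.Unit using (tt)
open import Function using (_∘_; flip)
open import Relation.Binary.PropositionalEquality
open import Relation.Nullary using (¬_)

IsGoodFrom : {V : Set} (G : Graph V) → EdgeLabelling G → V → Set
IsGoodFrom {V} G φ u =
  ∀ (v : V) (xs ys : List V) → NondecPath G φ u v xs → NondecPath G φ u v ys → xs ≡ ys

module _ {V : Set} {G : Graph V} {φ : EdgeLabelling G} where

  NondecPath-tail : ∀ {u v w ws} → NondecPath G φ u v (u ∷ w ∷ ws) → NondecPath G φ w v (w ∷ ws)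
  NondecPath-tail (_ , l , _ ∷ u , (_ , es) , ls) = refl , l , u , es , Linked.tail ls

  Edges-++⁻ˡ : ∀ ps {qs} → Edges G (ps ++ qs) → Edges G ps
  Edges-++⁻ˡ []           _        = tt
  Edges-++⁻ˡ (p ∷ [])     _        = tt
  Edges-++⁻ˡ (p ∷ p′ ∷ ps) (e , es) = e , Edges-++⁻ˡ (p′ ∷ ps) es

  labels-++⁻ˡ : ∀ ps {qs} (es : Edges G (ps ++ qs)) →
    Linked _≤_ (labels G φ (ps ++ qs) es) → Linked _≤_ (labels G φ ps (Edges-++⁻ˡ ps es))
  labels-++⁻ˡ []                 _        _        = []
  labels-++⁻ˡ (p ∷ [])           _        _        = []
  labels-++⁻ˡ (p ∷ p′ ∷ [])      _        _        = [-]
  labels-++⁻ˡ (p ∷ p′ ∷ p″ ∷ ps) (_ , es) (l ∷ ls) = l ∷ labels-++⁻ˡ (p′ ∷ p″ ∷ ps) es ls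

  Unique-++⁻ˡ : ∀ (ps : List V) {qs} → Unique (ps ++ qs) → Unique ps
  Unique-++⁻ˡ []       _         = []
  Unique-++⁻ˡ (p ∷ ps) (p∉ ∷ un) = All.++⁻ˡ ps p∉ ∷ Unique-++⁻ˡ ps un

  NondecPath-++⁻ˡ : ∀ ps {qs u v w} →
    NondecPath G φ u v (ps ++ qs) → last ps ≡ just w → NondecPath G φ u w ps
  NondecPath-++⁻ˡ []           _                     ()
  NondecPath-++⁻ˡ ps@(_ ∷ _) (h , _ , un , es , ls) l =
    h , l , Unique-++⁻ˡ ps un , Edges-++⁻ˡ ps es , labels-++⁻ˡ ps es ls

record LabelledEmbedding {V W : Set} {G : Graph V} {H : Graph W}
                         (φ : EdgeLabelling G) (ψ : EdgeLabelling H) : Set where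
  field
    to           : V → W
    to-injective : ∀ {x y} → to x ≡ to y → x ≡ y
    adj-≡        : ∀ x y → adj H (to x) (to y) ≡ adj G x y
    lab-≡        : ∀ {x y} (e : Adj G x y) (e′ : Adj H (to x) (to y)) →
                   lab ψ (to x) (to y) e′ ≡ lab φ x y e

  adj⁺ : ∀ {x y} → Adj G x y → Adj H (to x) (to y)
  adj⁺ {x} {y} = subst T (sym (adj-≡ x y))

  adj⁻ : ∀ {x y} → Adj H (to x) (to y) → Adj G x y
  adj⁻ {x} {y} = subst T (adj-≡ x y)

module _ {V W : Set} {G : Graph V} {H : Graph W} {φ : EdgeLabelling G} {ψ : EdgeLabelling H}
         (f : LabelledEmbedding φ ψ) where
  open LabelledEmbedding f

  private
    map-just⁻ : ∀ {u} (mx : Maybe V) → Maybe.map to mx ≡ just (to u) → mx ≡ just u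
    map-just⁻ (just x) eq = cong just (to-injective (just-injective eq))

  Edges-map⁺ : ∀ xs → Edges G xs → Edges H (map to xs)
  Edges-map⁺ []          _        = tt
  Edges-map⁺ (x ∷ [])    _        = tt
  Edges-map⁺ (x ∷ y ∷ xs) (e , es) = adj⁺ e , Edges-map⁺ (y ∷ xs) es

  labels-map⁺ : ∀ xs (es : Edges G xs) → labels H ψ (map to xs) (Edges-map⁺ xs es) ≡ labels G φ xs es
  labels-map⁺ []          _        = refl
  labels-map⁺ (x ∷ [])    _        = refl
  labels-map⁺ (x ∷ y ∷ xs) (e , es) = cong₂ _∷_ (lab-≡ e (adj⁺ e)) (labels-map⁺ (y ∷ xs) es)

  Edges-map⁻ : ∀ xs → Edges H (map to xs) → Edges G xs
  Edges-map⁻ []          _        = tt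
  Edges-map⁻ (x ∷ [])    _        = tt
  Edges-map⁻ (x ∷ y ∷ xs) (e , es) = adj⁻ e , Edges-map⁻ (y ∷ xs) es

  labels-map⁻ : ∀ xs (es : Edges H (map to xs)) →
    labels G φ xs (Edges-map⁻ xs es) ≡ labels H ψ (map to xs) es
  labels-map⁻ []          _        = refl
  labels-map⁻ (x ∷ [])    _        = refl
  labels-map⁻ (x ∷ y ∷ xs) (e , es) = cong₂ _∷_ (sym (lab-≡ (adj⁻ e) e)) (labels-map⁻ (y ∷ xs) es)

  NondecPath-map⁺ : ∀ {u v xs} → NondecPath G φ u v xs → NondecPath H ψ (to u) (to v) (map to xs)
  NondecPath-map⁺ {xs = xs} (h , l , un , es , ls) =
    trans (head-map {f = to} xs) (cong (Maybe.map to) h) ,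
    trans (last-map to xs) (cong (Maybe.map to) l) ,
    Unique.map⁺ to-injective un ,
    Edges-map⁺ xs es ,
    subst (Linked _≤_) (sym (labels-map⁺ xs es)) ls

  NondecPath-map⁻ : ∀ {u v xs} → NondecPath H ψ (to u) (to v) (map to xs) → NondecPath G φ u v xs
  NondecPath-map⁻ {xs = xs} (h , l , un , es , ls) =
    map-just⁻ (head xs) (trans (sym (head-map {f = to} xs)) h) ,
    map-just⁻ (last xs) (trans (sym (last-map to xs)) l) ,
    Unique.map⁻ un ,
    Edges-map⁻ xs es ,
    subst (Linked _≤_) (sym (labels-map⁻ xs es)) ls

  IsGoodFrom-pullback : ∀ {u} → IsGoodFrom H ψ (to u) → IsGoodFrom G φ u
  IsGoodFrom-pullback good v xs ys p q =
    map-injective to-injective (good (to v) _ _ (NondecPath-map⁺ p) (NondecPath-map⁺ q))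

module _ {m n : ℕ} (G : Graph (Fin m)) (H : Graph (Fin n)) (M : Fin m → Fin n → Bool)
         (φ : EdgeLabelling G) (ψ : EdgeLabelling H) (c : ℚ) where

  crossLab : ∀ x y → Adj (glue G H M) x y → ℚ
  crossLab (inj₁ a) (inj₁ a′) e = lab φ a a′ e
  crossLab (inj₂ b) (inj₂ b′) e = lab ψ b b′ e
  crossLab (inj₁ _) (inj₂ _)  _ = c
  crossLab (inj₂ _) (inj₁ _)  _ = c

  crossLabelling : EdgeLabelling (glue G H M)
  crossLabelling = record { lab = crossLab ; lab-sym = crossLab-sym }
    where
    crossLab-sym : ∀ x y (e : Adj (glue G H M) x y) →
      crossLab x y e ≡ crossLab y x (Adj-sym (glue G H M) {x} {y} e)
    crossLab-sym (inj₁ a) (inj₁ a′) e = lab-sym φ a a′ e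
    crossLab-sym (inj₂ b) (inj₂ b′) e = lab-sym ψ b b′ e
    crossLab-sym (inj₁ _) (inj₂ _)  _ = refl
    crossLab-sym (inj₂ _) (inj₁ _)  _ = refl

  inj₁-embedding : LabelledEmbedding φ crossLabelling
  inj₁-embedding = record
    { to           = inj₁
    ; to-injective = inj₁-injective
    ; adj-≡        = λ _ _ → refl
    ; lab-≡        = λ {a} {a′} e e′ → cong (lab φ a a′) (T-irrelevant e′ e)
    }

  module _ (ψ<c : ∀ b b′ e → lab ψ b b′ e < c)
           (M-left-unique : ∀ a a′ b → T (M a b) → T (M a′ b) → a ≡ a′) where

    crossing-is-last : ∀ {x b w ws v} →
      ¬ NondecPath (glue G H M) crossLabelling (inj₁ x) v (inj₁ x ∷ inj₂ b ∷ w ∷ ws)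
    crossing-is-last {w = inj₂ b′} (_ , _ , _ , (_ , e′ , _) , c≤ ∷ _) =
      <-irrefl refl (<-≤-trans (ψ<c _ b′ e′) c≤)
    crossing-is-last {w = inj₁ x′} (_ , _ , (_ ∷ x≢x′ ∷ _) ∷ _ , (e , e′ , _) , _) =
      x≢x′ (cong inj₁ (M-left-unique _ x′ _ e e′))

    path-to-G : ∀ {a z} xs → NondecPath (glue G H M) crossLabelling (inj₁ a) (inj₁ z) xs →
      Σ (List (Fin m)) λ as → xs ≡ map inj₁ as
    path-to-G []                        (() , _)
    path-to-G (inj₂ _ ∷ _)              (() , _)
    path-to-G (inj₁ x ∷ [])             _ = x ∷ [] , refl
    path-to-G (inj₁ x ∷ inj₂ b ∷ [])    (_ , () , _)
    path-to-G (inj₁ x ∷ inj₂ b ∷ _ ∷ _) p@(refl , _) = ⊥-elim (crossing-is-last p)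
    path-to-G (inj₁ x ∷ inj₁ y ∷ xs)    p@(refl , _) with path-to-G (inj₁ y ∷ xs) (NondecPath-tail p)
    ... | as , eq = x ∷ as , cong (inj₁ x ∷_) eq

    path-to-H : ∀ {a b} xs → NondecPath (glue G H M) crossLabelling (inj₁ a) (inj₂ b) xs →
      Σ (Fin m) λ z → Σ (List (Fin m ⊎ Fin n)) λ ps →
        T (M z b) × last ps ≡ just (inj₁ z) × xs ≡ ps ∷ʳ inj₂ b
    path-to-H []                        (() , _)
    path-to-H (inj₂ _ ∷ _)              (() , _)
    path-to-H (inj₁ x ∷ [])             (_ , () , _)
    path-to-H (inj₁ x ∷ inj₂ b ∷ [])    (refl , refl , _ , (e , _) , _) = x , inj₁ x ∷ [] , e , refl , refl
    path-to-H (inj₁ x ∷ inj₂ b ∷ _ ∷ _) p@(refl , _) = ⊥-elim (crossing-is-last p)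
    path-to-H (inj₁ x ∷ inj₁ y ∷ xs)    p@(refl , _) with path-to-H (inj₁ y ∷ xs) (NondecPath-tail p)
    ... | z , [] , _ , () , _
    ... | z , ps@(_ ∷ _) , e , l , eq = z , inj₁ x ∷ ps , e , l , cong (inj₁ x ∷_) eq

    module _ (φ-good : IsGood G φ) (a : Fin m) where

      IsGoodFrom-inj₁-to-inj₁ : ∀ z xs ys →
        NondecPath (glue G H M) crossLabelling (inj₁ a) (inj₁ z) xs →
        NondecPath (glue G H M) crossLabelling (inj₁ a) (inj₁ z) ys → xs ≡ ys
      IsGoodFrom-inj₁-to-inj₁ z xs ys p q with path-to-G xs p | path-to-G ys q
      ... | as , refl | as′ , refl =
        cong (map inj₁) (φ-good a z as as′
          (NondecPath-map⁻ inj₁-embedding p) (NondecPath-map⁻ inj₁-embedding q))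

      IsGoodFrom-inj₁ : IsGoodFrom (glue G H M) crossLabelling (inj₁ a)
      IsGoodFrom-inj₁ (inj₁ z) = IsGoodFrom-inj₁-to-inj₁ z
      IsGoodFrom-inj₁ (inj₂ b) xs ys p q with path-to-H xs p | path-to-H ys q
      ... | z , ps , e , l , refl | z′ , qs , e′ , l′ , refl with M-left-unique z z′ b e e′
      ... | refl = cong (_∷ʳ inj₂ b)
        (IsGoodFrom-inj₁-to-inj₁ z ps qs (NondecPath-++⁻ˡ ps p l) (NondecPath-++⁻ˡ qs q l′))

swap-embedding : ∀ {m n} {G : Graph (Fin m)} {H : Graph (Fin n)} {M : Fin m → Fin n → Bool}
  {φ : EdgeLabelling G} {ψ : EdgeLabelling H} {c : ℚ} →
  LabelledEmbedding (crossLabelling G H M φ ψ c) (crossLabelling H G (flip M) ψ φ c)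
swap-embedding {G = G} {H} {M} {φ} {ψ} = record
  { to           = swap
  ; to-injective = swap-injective
  ; adj-≡        = adj-≡
  ; lab-≡        = λ {x} {y} → lab-≡ x y
  }
  where
  swap-injective : ∀ {x y : Fin _ ⊎ Fin _} → swap x ≡ swap y → x ≡ y
  swap-injective {x} {y} eq = trans (sym (swap-involutive x)) (trans (cong swap eq) (swap-involutive y))

  adj-≡ : ∀ x y → adj (glue H G (flip M)) (swap x) (swap y) ≡ adj (glue G H M) x y
  adj-≡ (inj₁ _) (inj₁ _) = refl
  adj-≡ (inj₁ _) (inj₂ _) = refl
  adj-≡ (inj₂ _) (inj₁ _) = refl
  adj-≡ (inj₂ _) (inj₂ _) = refl

  lab-≡ : ∀ x y e e′ → crossLab H G (flip M) ψ φ _ (swap x) (swap y) e′ ≡ crossLab G H M φ ψ _ x y e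
  lab-≡ (inj₁ a) (inj₁ a′) e e′ = cong (lab φ a a′) (T-irrelevant e′ e)
  lab-≡ (inj₁ _) (inj₂ _)  _ _  = refl
  lab-≡ (inj₂ _) (inj₁ _)  _ _  = refl
  lab-≡ (inj₂ b) (inj₂ b′) e e′ = cong (lab ψ b b′) (T-irrelevant e′ e)

crossLabelling-good : ∀ {m n} {G : Graph (Fin m)} {H : Graph (Fin n)} {M : Fin m → Fin n → Bool}
  {φ : EdgeLabelling G} {ψ : EdgeLabelling H} {c : ℚ} →
  IsGood G φ → IsGood H ψ → IsCrossMatching M →
  (∀ a a′ e → lab φ a a′ e < c) → (∀ b b′ e → lab ψ b b′ e < c) →
  IsGood (glue G H M) (crossLabelling G H M φ ψ c)
crossLabelling-good {G = G} {H} {M} {φ} {ψ} {c} φ-good ψ-good (M-right-unique , M-left-unique) φ<c ψ<c =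
  λ where
    (inj₁ a) → IsGoodFrom-inj₁ G H M φ ψ c ψ<c M-left-unique φ-good a
    (inj₂ b) → IsGoodFrom-pullback swap-embedding
                 (IsGoodFrom-inj₁ H G (flip M) ψ φ c φ<c (λ b b′ a → M-right-unique a b b′) ψ-good b)

Fin-upper-bound : ∀ k (f : Fin k → ℚ) → Σ ℚ λ B → ∀ i → f i ≤ B
Fin-upper-bound zero    f = 0ℚ , λ ()
Fin-upper-bound (suc k) f with Fin-upper-bound k (f ∘ suc)
... | B , f≤B = f zero ⊔ B , λ where
  zero    → p≤p⊔q (f zero) B
  (suc i) → ≤-trans (f≤B i) (p≤q⊔p (f zero) B)

labels-upper-bound : ∀ {m} {G : Graph (Fin m)} (φ : EdgeLabelling G) →
  Σ ℚ λ B → ∀ a a′ e → lab φ a a′ e ≤ B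
labels-upper-bound {m} {G} φ = proj₁ (Fin-upper-bound m rowBound) , λ a a′ e →
  ≤-trans (≤-trans (≤-orZero (adj G a a′) (lab φ a a′) e) (proj₂ (Fin-upper-bound m (weight a)) a′))
          (proj₂ (Fin-upper-bound m rowBound) a)
  where
  orZero : (b : Bool) → (T b → ℚ) → ℚ
  orZero true  ℓ = ℓ tt
  orZero false _ = 0ℚ

  ≤-orZero : ∀ b (ℓ : T b → ℚ) e → ℓ e ≤ orZero b ℓ
  ≤-orZero true _ _ = ≤-refl

  weight : Fin m → Fin m → ℚ
  weight a a′ = orZero (adj G a a′) (lab φ a a′)

  rowBound : Fin m → ℚ
  rowBound a = proj₁ (Fin-upper-bound m (weight a))

p<p+1 : ∀ p → p < p + 1ℚ
p<p+1 p = subst (_< p + 1ℚ) (+-identityʳ p) (+-monoʳ-< p (positive⁻¹ 1ℚ))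

labels-strict-upper-bound : ∀ {m n} {G : Graph (Fin m)} {H : Graph (Fin n)}
  (φ : EdgeLabelling G) (ψ : EdgeLabelling H) →
  Σ ℚ λ c → (∀ a a′ e → lab φ a a′ e < c) × (∀ b b′ e → lab ψ b b′ e < c)
labels-strict-upper-bound φ ψ with labels-upper-bound φ | labels-upper-bound ψ
... | Bφ , φ≤Bφ | Bψ , ψ≤Bψ =
  Bφ ⊔ Bψ + 1ℚ ,
  (λ a a′ e → ≤-<-trans (≤-trans (φ≤Bφ a a′ e) (p≤p⊔q Bφ Bψ)) (p<p+1 (Bφ ⊔ Bψ))) ,
  (λ b b′ e → ≤-<-trans (≤-trans (ψ≤Bψ b b′ e) (p≤q⊔p Bφ Bψ)) (p<p+1 (Bφ ⊔ Bψ)))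

lemma2 : (m n : ℕ) (G : Graph (Fin m)) (H : Graph (Fin n)) (M : Fin m → Fin n → Bool) →
    AdmitsGood G → AdmitsGood H → IsCrossMatching M → AdmitsGood (glue G H M)
lemma2 m n G H M (φ , φ-good) (ψ , ψ-good) matching with labels-strict-upper-bound φ ψ
... | c , φ<c , ψ<c = crossLabelling G H M φ ψ c , crossLabelling-good φ-good ψ-good matching φ<c ψ<c
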